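{- Let $N$ be a network and $v$ a node of $N$. Then $v$ is an ambiguous leaf if and only if $v\in V_R(N)$, $\deg_u(v,N)=1$, and $\deg_o(v,N)=\deg_i(v,N)=0$.
   Context: A semidirected graph is $N=(V,E)$ with $E=E_U\sqcup E_D$, $E_U$ undirected edges $uv$, $E_D$ directed edges $(u,v)$ ($u$ parent, $v$ child); parallel directed edges allowed, no self-loops. $\deg_i(v,N)$, $\deg_o(v,N)$ are the numbers of directed edges with child $v$, resp. parent $v$; $\deg_u(v,N)$ the number of undirected edges incident to $v$. $N'$ is compatible with $N$ if obtained by directing some undirected edges. A semidirected cycle is a semidirected graph whose undirected edges can be directed to make it a directed cycle; acyclic (SDAG) means containing no semidirected cycle; DAG = acyclic directed graph. Tree node: $\deg_i\le1$; hybrid node otherwise. Hybrid edge: directed edge with hybrid child; $E_H(N)$ their set. SDAG $N'$ is phylogenetically compatible with SDAG $N$ if compatible and $E_H(N')=E_H(N)$; a rooted partner of $N$ is a DAG phylogenetically compatible with $N$; a network is an SDAG admitting a rooted partner. In a DAG, a leaf is a node of out-degree 0. A node is a rooted leaf of $N$ if it is a leaf in every rooted partner of $N$, an unrooted leaf if it is a leaf in some rooted partner, and an ambiguous leaf if it is an unrooted leaf but not a rooted leaf. A semidirected path from $u_0$ to $u_n$ is $u_0\dots u_n$ with $u_{i-1}u_i$ or $(u_{i-1},u_i)$ an edge for each $i$; $v\lesssim u$ if there is a semidirected path from $u$ to $v$; $u\sim v$ if $u\lesssim v$ and $v\lesssim u$. An undirected component is the subgraph induced by a $\sim$-class; a root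 component is one whose class is maximal under $\lesssim$; $V_R(N)$ is the set of nodes lying in root components. -}

module Defs where

open import Data.Nat using (ℕ; zero; suc; _+_; _≥_)
open import Data.Nat.DivMod using (_%_; m%n<n)
open import Data.Fin using (Fin; zero; suc; toℕ; fromℕ<; splitAt; _↑ˡ_; _↑ʳ_)
open import Data.Fin.Properties using (_≟_)
open import Data.Product using (Σ; ∃; _×_; _,_; proj₁; proj₂)
open import Data.Sum using (_⊎_; inj₁; inj₂)
open import Data.List using (List; length; filter)
open import Data.List.Base using (allFin)
open import Relation.Binary.PropositionalEquality using (_≡_; _≢_)
open import Relation.Nullary using (¬_)
open import Function.Definitions using (Injective)
open import Function.Bundles using (_⇔_)

-- Undirected edges are indexed by Fin mU, edge i joins the two ends of U i
-- (the order inside the pair is irrelevant); directed edges are indexed by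
-- Fin mD, edge j is (parent , child) = D j.  Parallel edges are allowed,
-- self-loops are not.
record SDGraph (n : ℕ) : Set where
  field
    mU : ℕ
    mD : ℕ
    U  : Fin mU → Fin n × Fin n
    D  : Fin mD → Fin n × Fin n
    U-noloop : ∀ i → proj₁ (U i) ≢ proj₂ (U i)
    D-noloop : ∀ j → proj₁ (D j) ≢ proj₂ (D j)
open SDGraph public

module _ {n : ℕ} (N : SDGraph n) where

  Edge : Set
  Edge = Fin (mU N) ⊎ Fin (mD N)

  Joins : Edge → Fin n → Fin n → Set
  Joins (inj₁ i) a b = (U N i ≡ (a , b)) ⊎ (U N i ≡ (b , a))
  Joins (inj₂ j) a b = D N j ≡ (a , b)

  deg-i : Fin n → ℕ
  deg-i v = length (filter (λ j → proj₂ (D N j) ≟ v) (allFin (mD N)))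

  deg-o : Fin n → ℕ
  deg-o v = length (filter (λ j → proj₁ (D N j) ≟ v) (allFin (mD N)))

  deg-u : Fin n → ℕ
  deg-u v = length (filter (λ i → proj₁ (U N i) ≟ v) (allFin (mU N)))
          + length (filter (λ i → proj₂ (U N i) ≟ v) (allFin (mU N)))

  IsHybridNode : Fin n → Set
  IsHybridNode v = deg-i v ≥ 2

  IsHybridEdge : Fin (mD N) → Set
  IsHybridEdge j = IsHybridNode (proj₂ (D N j))

cnext : ∀ {k} → Fin (suc k) → Fin (suc k)
cnext {k} i = fromℕ< (m%n<n (suc (toℕ i)) (suc k))

module _ {n : ℕ} (N : SDGraph n) where

  record SDCycle : Set where
    field
      k        : ℕ
      node     : Fin (suc k) → Fin n
      edge     : Fin (suc k) → Edge N
      node-inj : Injective _≡_ _≡_ node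
      edge-inj : Injective _≡_ _≡_ edge
      step     : ∀ i → Joins N (edge i) (node i) (node (cnext i))

  Acyclic : Set
  Acyclic = ¬ SDCycle

  data SDPath : Fin n → Fin n → Set where
    here : ∀ {u} → SDPath u u
    step : ∀ {u w v} (e : Edge N) → Joins N e u w → SDPath w v → SDPath u v

  _≲_ : Fin n → Fin n → Set
  v ≲ u = SDPath u v

  -- V_R(N): v lies in a root component, i.e. the ∼-class of v is maximal
  -- under ≲ : every u above v is also below v.
  InVR : Fin n → Set
  InVR v = ∀ u → v ≲ u → u ≲ v

data Dir : Set where
  fwd bwd : Dir

orientPair : ∀ {n} → Dir → Fin n × Fin n → Fin n × Fin n
orientPair fwd (a , b) = (a , b)
orientPair bwd (a , b) = (b , a)

orientPair-noloop : ∀ {n} d (p : Fin n × Fin n) → proj₁ p ≢ proj₂ p →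
                    proj₁ (orientPair d p) ≢ proj₂ (orientPair d p)
orientPair-noloop fwd (a , b) ne eq = ne eq
orientPair-noloop bwd (a , b) ne eq = ne (Relation.Binary.PropositionalEquality.sym eq)

-- Its directed edges are Fin (mD + mU): the original directed
-- edge j is  j ↑ˡ mU , the directed version of undirected edge i is  mD ↑ʳ i.
module _ {n : ℕ} (N : SDGraph n) (σ : Fin (mU N) → Dir) where

  private
    D' : Fin (mD N + mU N) → Fin n × Fin n
    D' k with splitAt (mD N) k
    ... | inj₁ j = D N j
    ... | inj₂ i = orientPair (σ i) (U N i)

    D'-noloop : ∀ k → proj₁ (D' k) ≢ proj₂ (D' k)
    D'-noloop k with splitAt (mD N) k
    ... | inj₁ j = D-noloop N j
    ... | inj₂ i = orientPair-noloop (σ i) (U N i) (U-noloop N i)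

  orient : SDGraph n
  orient = record
    { mU = 0 ; mD = mD N + mU N
    ; U = λ () ; D = D'
    ; U-noloop = λ () ; D-noloop = D'-noloop }

module _ {n : ℕ} (N : SDGraph n) where

  -- σ yields a rooted partner of N: the (compatible, fully directed) graph
  -- orient N σ is a DAG with E_H(orient N σ) = E_H(N) (edges identified as above).
  IsRootedPartner : (Fin (mU N) → Dir) → Set
  IsRootedPartner σ =
      Acyclic (orient N σ)
    × (∀ j → IsHybridEdge N j ⇔ IsHybridEdge (orient N σ) (j ↑ˡ mU N))
    × (∀ i → ¬ IsHybridEdge (orient N σ) (mD N ↑ʳ i))

  IsNetwork : Set
  IsNetwork = Acyclic N × Σ (Fin (mU N) → Dir) IsRootedPartner

  IsLeafIn : ∀ {m} → SDGraph m → Fin m → Set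
  IsLeafIn G v = deg-o G v ≡ 0

  RootedLeaf : Fin n → Set
  RootedLeaf v = ∀ σ → IsRootedPartner σ → IsLeafIn (orient N σ) v

  UnrootedLeaf : Fin n → Set
  UnrootedLeaf v = Σ (Fin (mU N) → Dir) λ σ → IsRootedPartner σ × IsLeafIn (orient N σ) v

  AmbiguousLeaf : Fin n → Set
  AmbiguousLeaf v = UnrootedLeaf v × ¬ RootedLeaf v

-- Undirected edges are never hybrid, so in every rooted partner an undirected edge entering
-- a node is its only incoming edge.  Hence an ambiguous leaf v (a leaf of one partner but not
-- of all) has exactly one incident edge, which is undirected, and each partner orients it
-- either into v (v is a leaf) or out of v (v is a source).  The theorem therefore reduces to:
-- V_R(N) consists of the nodes that are sources of some rooted partner.  A source v of a
-- partner lies in V_R(N) because the nodes reached from v along undirected edges are closed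
-- under predecessors in N.  Conversely, for v ∈ V_R(N) walk up from v in a partner to a source
-- r; every edge on the way is undirected in N (a directed one would close a cycle through v),
-- and reversing these edges one at a time moves the source from r down to v.

module Submission where

open import Defs
open import Data.Empty using (⊥; ⊥-elim)
open import Data.Fin using (Fin; zero; suc; toℕ; fromℕ; inject₁; _↑ˡ_; _↑ʳ_; splitAt; join)
open import Data.Fin.Properties
  using (_≟_; any?; injective⇒≤; toℕ-injective; toℕ-fromℕ<; toℕ-fromℕ; toℕ-inject₁; toℕ<n; fromℕ≢inject₁;
         splitAt-↑ˡ; splitAt-↑ʳ; splitAt⁻¹-↑ˡ; splitAt⁻¹-↑ʳ; join-splitAt; ↑ʳ-injective)
open import Data.List using (List; []; _∷_; length; filter; allFin)
open import Data.List.Membership.Propositional using (_∈_; _∉_)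
open import Data.List.Membership.Propositional.Properties using (∈-filter⁺; ∈-filter⁻; ∈-allFin; ∈-length)
open import Data.List.Properties using (filter-none; filter-≐)
open import Data.List.Relation.Unary.All using (_∷_; tabulate)
open import Data.List.Relation.Unary.AllPairs using ([]; _∷_)
open import Data.List.Relation.Unary.Any using (here; there)
open import Data.List.Relation.Unary.Unique.Propositional using (Unique)
open import Data.List.Relation.Unary.Unique.Propositional.Properties as Unique using (allFin⁺)
open import Data.Nat using (ℕ; zero; suc; _+_; _%_; _≤_; _<_; z≤n; s≤s)
open import Data.Nat.DivMod using (m%n<n; m<n⇒m%n≡m; n%n≡0)
open import Data.Nat.Induction using (<-wellFounded)
open import Data.Nat.Properties using (0≢1+n; ≤-refl; ≤-trans; ≤-antisym; <-irrefl; <⇒≤; +-suc; m≤n⇒m≤1+n; suc-injective)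
open import Data.Product using (Σ; ∃; ∃-syntax; _×_; _,_; proj₁; proj₂)
import Data.Product as Product
open import Data.Product.Properties using () renaming (≡-dec to ×-≡-dec)
open import Data.Sum using (_⊎_; inj₁; inj₂; swap)
open import Data.Sum.Properties using (swap-involutive)
open import Data.Unit using (⊤; tt)
open import Function using (_∘_; _on_; _⇔_; mk⇔; Equivalence)
open import Function.Construct.Composition using (_⇔-∘_)
open import Function.Construct.Symmetry using (⇔-sym)
open import Function.Definitions using (Injective)
open import Induction.WellFounded using (Acc; acc)
open import Level using (0ℓ)
open import Relation.Binary.Construct.On as On using ()
open import Relation.Binary.PropositionalEquality
open import Relation.Nullary using (¬_; Dec; yes; no)
open import Relation.Nullary.Decidable using (map′; _⊎-dec_; _×-dec_)
open import Relation.Unary using (Pred; Decidable; _⊆_; _≐_)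
open import Relation.Unary.Properties using (_∪?_)

module _ {A : Set} where

  length≥2 : ∀ {x y : A} {xs} → x ∈ xs → y ∈ xs → x ≢ y → 2 ≤ length xs
  length≥2 (here refl) (here refl) x≢y = ⊥-elim (x≢y refl)
  length≥2 (here _)    (there y∈)  _   = s≤s (∈-length y∈)
  length≥2 (there x∈)  (here _)    _   = s≤s (∈-length x∈)
  length≥2 (there x∈)  (there y∈)  x≢y = m≤n⇒m≤1+n (length≥2 x∈ y∈ x≢y)

  Unique-length≤1 : ∀ {xs : List A} → Unique xs → (∀ {x y} → x ∈ xs → y ∈ xs → x ≡ y) → length xs ≤ 1
  Unique-length≤1 []                  _    = z≤n
  Unique-length≤1 (_ ∷ [])            _    = ≤-refl
  Unique-length≤1 ((x≢y ∷ _) ∷ _ ∷ _) all≡ = ⊥-elim (x≢y (all≡ (here refl) (there (here refl))))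

module _ {A : Set} {P Q : Pred A 0ℓ} (P? : Decidable P) (Q? : Decidable Q) where

  length-filter-≤ : P ⊆ Q → ∀ xs → length (filter P? xs) ≤ length (filter Q? xs)
  length-filter-≤ P⊆Q [] = z≤n
  length-filter-≤ P⊆Q (y ∷ ys) with P? y | Q? y
  ... | yes Py | no ¬Qy = ⊥-elim (¬Qy (P⊆Q Py))
  ... | yes _  | yes _  = s≤s (length-filter-≤ P⊆Q ys)
  ... | no _   | yes _  = m≤n⇒m≤1+n (length-filter-≤ P⊆Q ys)
  ... | no _   | no _   = length-filter-≤ P⊆Q ys

  length-filter-< : P ⊆ Q → ∀ {x xs} → x ∈ xs → Q x → ¬ P x →
                    length (filter P? xs) < length (filter Q? xs)
  length-filter-< P⊆Q {xs = y ∷ ys} (here refl) Qx ¬Px with P? y | Q? y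
  ... | yes Py | _      = ⊥-elim (¬Px Py)
  ... | no _   | no ¬Qy = ⊥-elim (¬Qy Qx)
  ... | no _   | yes _  = s≤s (length-filter-≤ P⊆Q ys)
  length-filter-< P⊆Q {xs = y ∷ ys} (there x∈) Qx ¬Px with P? y | Q? y
  ... | yes Py | no ¬Qy = ⊥-elim (¬Qy (P⊆Q Py))
  ... | yes _  | yes _  = s≤s (length-filter-< P⊆Q x∈ Qx ¬Px)
  ... | no _   | yes _  = m≤n⇒m≤1+n (length-filter-< P⊆Q x∈ Qx ¬Px)
  ... | no _   | no _   = length-filter-< P⊆Q x∈ Qx ¬Px

  length-filter-∪ : (∀ {x} → P x → ¬ Q x) → ∀ xs →
                    length (filter P? xs) + length (filter Q? xs) ≡ length (filter (P? ∪? Q?) xs)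
  length-filter-∪ disj [] = refl
  length-filter-∪ disj (y ∷ ys) with P? y | Q? y
  ... | yes Py | yes Qy = ⊥-elim (disj Py Qy)
  ... | yes _  | no _   = cong suc (length-filter-∪ disj ys)
  ... | no _   | yes _  = trans (+-suc _ _) (cong suc (length-filter-∪ disj ys))
  ... | no _   | no _   = length-filter-∪ disj ys

count : ∀ {m} {P : Pred (Fin m) 0ℓ} → Decidable P → ℕ
count {m} P? = length (filter P? (allFin m))

module _ {m : ℕ} {P : Pred (Fin m) 0ℓ} (P? : Decidable P) where

  count-pos : ∀ {k} → P k → 0 < count P?
  count-pos Pk = ∈-length (∈-filter⁺ P? (∈-allFin _) Pk)

  count≡0⇒∁ : count P? ≡ 0 → ∀ k → ¬ P k
  count≡0⇒∁ eq k Pk = <-irrefl refl (subst (0 <_) eq (count-pos Pk))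

  ∁⇒count≡0 : (∀ k → ¬ P k) → count P? ≡ 0
  ∁⇒count≡0 ¬P = cong length (filter-none P? {xs = allFin m} (tabulate λ {k} _ → ¬P k))

  count≥2 : ∀ {k₁ k₂} → k₁ ≢ k₂ → P k₁ → P k₂ → 2 ≤ count P?
  count≥2 k₁≢k₂ Pk₁ Pk₂ =
    length≥2 {xs = filter P? (allFin m)} (∈-filter⁺ P? (∈-allFin _) Pk₁) (∈-filter⁺ P? (∈-allFin _) Pk₂) k₁≢k₂

  count≤1 : (∀ {k₁ k₂} → P k₁ → P k₂ → k₁ ≡ k₂) → count P? ≤ 1
  count≤1 P-unique = Unique-length≤1 {xs = filter P? (allFin m)} (Unique.filter⁺ P? (allFin⁺ m))
    λ k₁∈ k₂∈ → P-unique (proj₂ (∈-filter⁻ P? {xs = allFin m} k₁∈)) (proj₂ (∈-filter⁻ P? {xs = allFin m} k₂∈))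

module _ {m : ℕ} {P Q : Pred (Fin m) 0ℓ} (P? : Decidable P) (Q? : Decidable Q) where

  count-cong : P ≐ Q → count P? ≡ count Q?
  count-cong P≐Q = cong length (filter-≐ P? Q? P≐Q (allFin m))

  count-< : P ⊆ Q → ∀ {k} → Q k → ¬ P k → count P? < count Q?
  count-< P⊆Q Qk ¬Pk = length-filter-< P? Q? P⊆Q (∈-allFin _) Qk ¬Pk

  count-∪ : (∀ {k} → P k → ¬ Q k) → count P? + count Q? ≡ count (P? ∪? Q?)
  count-∪ disj = length-filter-∪ P? Q? disj (allFin m)

cnext-inject₁ : ∀ {k} (s : Fin k) → cnext (inject₁ s) ≡ suc s
cnext-inject₁ {k} s = toℕ-injective (begin
  toℕ (cnext (inject₁ s))      ≡⟨ toℕ-fromℕ< (m%n<n (suc (toℕ (inject₁ s))) (suc k)) ⟩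
  suc (toℕ (inject₁ s)) % suc k ≡⟨ cong (λ i → suc i % suc k) (toℕ-inject₁ s) ⟩
  suc (toℕ s) % suc k           ≡⟨ m<n⇒m%n≡m (s≤s (toℕ<n s)) ⟩
  suc (toℕ s)                   ∎)
  where open ≡-Reasoning

cnext-fromℕ : ∀ k → cnext (fromℕ k) ≡ zero
cnext-fromℕ k = toℕ-injective (begin
  toℕ (cnext (fromℕ k))      ≡⟨ toℕ-fromℕ< (m%n<n (suc (toℕ (fromℕ k))) (suc k)) ⟩
  suc (toℕ (fromℕ k)) % suc k ≡⟨ cong (λ i → suc i % suc k) (toℕ-fromℕ k) ⟩
  suc k % suc k               ≡⟨ n%n≡0 (suc k) ⟩
  0                           ∎)
  where open ≡-Reasoning

data LastView : ∀ {L} → Fin (suc L) → Set where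
  inner : ∀ {L} (s : Fin L) → LastView (inject₁ s)
  last  : ∀ {L} → LastView (fromℕ L)

lastView : ∀ {L} (t : Fin (suc L)) → LastView t
lastView {zero}  zero    = last
lastView {suc L} zero    = inner zero
lastView {suc L} (suc t) with lastView t
... | inner s = inner (suc s)
... | last    = last

module _ {n : ℕ} (G : SDGraph n) where

  open import Data.List.Membership.DecPropositional (_≟_ {n}) using (_∈?_)

  Joins? : ∀ e a b → Dec (Joins G e a b)
  Joins? (inj₁ i) a b = ×-≡-dec _≟_ _≟_ (U G i) (a , b) ⊎-dec ×-≡-dec _≟_ _≟_ (U G i) (b , a)
  Joins? (inj₂ j) a b = ×-≡-dec _≟_ _≟_ (D G j) (a , b)

  Joins-tail-endpoint : ∀ e {a b c d} → Joins G e a b → Joins G e c d → a ≡ c ⊎ a ≡ d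
  Joins-tail-endpoint (inj₂ j) refl      refl       = inj₁ refl
  Joins-tail-endpoint (inj₁ i) (inj₁ eq) (inj₁ eq′) = inj₁ (cong proj₁ (trans (sym eq) eq′))
  Joins-tail-endpoint (inj₁ i) (inj₁ eq) (inj₂ eq′) = inj₂ (cong proj₁ (trans (sym eq) eq′))
  Joins-tail-endpoint (inj₁ i) (inj₂ eq) (inj₁ eq′) = inj₂ (cong proj₂ (trans (sym eq) eq′))
  Joins-tail-endpoint (inj₁ i) (inj₂ eq) (inj₂ eq′) = inj₁ (cong proj₂ (trans (sym eq) eq′))

  _++ₚ_ : ∀ {a b c} → SDPath G a b → SDPath G b c → SDPath G a c
  here       ++ₚ q = q
  step e J p ++ₚ q = step e J (p ++ₚ q)

  len : ∀ {a b} → SDPath G a b → ℕ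
  len here         = 0
  len (step e J p) = suc (len p)

  nodeAt : ∀ {a b} (p : SDPath G a b) → Fin (suc (len p)) → Fin n
  nodeAt {a} p        zero    = a
  nodeAt (step e J p) (suc t) = nodeAt p t

  edgeAt : ∀ {a b} (p : SDPath G a b) → Fin (len p) → Edge G
  edgeAt (step e J p) zero    = e
  edgeAt (step e J p) (suc s) = edgeAt p s

  nodeAt-last : ∀ {a b} (p : SDPath G a b) → nodeAt p (fromℕ (len p)) ≡ b
  nodeAt-last here         = refl
  nodeAt-last (step e J p) = nodeAt-last p

  nodeAt-step : ∀ {a b} (p : SDPath G a b) s → Joins G (edgeAt p s) (nodeAt p (inject₁ s)) (nodeAt p (suc s))
  nodeAt-step (step e J p) zero    = J
  nodeAt-step (step e J p) (suc s) = nodeAt-step p s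

  nodes : ∀ {a b} → SDPath G a b → List (Fin n)
  nodes {a} here         = a ∷ []
  nodes {a} (step e J p) = a ∷ nodes p

  nodeAt∈nodes : ∀ {a b} (p : SDPath G a b) t → nodeAt p t ∈ nodes p
  nodeAt∈nodes here         zero    = here refl
  nodeAt∈nodes (step e J p) zero    = here refl
  nodeAt∈nodes (step e J p) (suc t) = there (nodeAt∈nodes p t)

  Simple : ∀ {a b} → SDPath G a b → Set
  Simple here             = ⊤
  Simple {a} (step e J p) = a ∉ nodes p × Simple p

  nodeAt-injective : ∀ {a b} (p : SDPath G a b) → Simple p → ∀ {t₁ t₂} → nodeAt p t₁ ≡ nodeAt p t₂ → t₁ ≡ t₂
  nodeAt-injective here         _          {zero}   {zero}   _  = refl
  nodeAt-injective (step e J p) _          {zero}   {zero}   _  = refl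
  nodeAt-injective (step e J p) (a∉ , _)   {zero}   {suc t₂} eq = ⊥-elim (a∉ (subst (_∈ nodes p) (sym eq) (nodeAt∈nodes p t₂)))
  nodeAt-injective (step e J p) (a∉ , _)   {suc t₁} {zero}   eq = ⊥-elim (a∉ (subst (_∈ nodes p) eq (nodeAt∈nodes p t₁)))
  nodeAt-injective (step e J p) (_ , simp) {suc t₁} {suc t₂} eq = cong suc (nodeAt-injective p simp eq)

  first-edge-unrepeated : ∀ {a w b e} → Joins G e a w → (p : SDPath G w b) → a ∉ nodes p → ∀ s → e ≢ edgeAt p s
  first-edge-unrepeated {e = e} J p a∉ s refl with Joins-tail-endpoint e J (nodeAt-step p s)
  ... | inj₁ eq = a∉ (subst (_∈ nodes p) (sym eq) (nodeAt∈nodes p (inject₁ s)))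
  ... | inj₂ eq = a∉ (subst (_∈ nodes p) (sym eq) (nodeAt∈nodes p (suc s)))

  edgeAt-injective : ∀ {a b} (p : SDPath G a b) → Simple p → ∀ {s₁ s₂} → edgeAt p s₁ ≡ edgeAt p s₂ → s₁ ≡ s₂
  edgeAt-injective (step e J p) _          {zero}   {zero}   _  = refl
  edgeAt-injective (step e J p) (a∉ , _)   {zero}   {suc s}  eq = ⊥-elim (first-edge-unrepeated J p a∉ s eq)
  edgeAt-injective (step e J p) (a∉ , _)   {suc s}  {zero}   eq = ⊥-elim (first-edge-unrepeated J p a∉ s (sym eq))
  edgeAt-injective (step e J p) (_ , simp) {suc s₁} {suc s₂} eq = cong suc (edgeAt-injective p simp eq)

  suffix : ∀ {a b c} (p : SDPath G a b) → c ∈ nodes p → Simple p → Σ (SDPath G c b) Simple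
  suffix here         (here refl) _          = here , tt
  suffix (step e J p) (here refl) simp       = step e J p , simp
  suffix (step e J p) (there c∈)  (_ , simp) = suffix p c∈ simp

  simplify : ∀ {a b} → SDPath G a b → Σ (SDPath G a b) Simple
  simplify here = here , tt
  simplify {a} (step e J p) with simplify p
  ... | q , simp with a ∈? nodes q
  ...   | yes a∈ = suffix q a∈ simp
  ...   | no  a∉ = step e J q , a∉ , simp

  Simple⇒len<n : ∀ {a b} (p : SDPath G a b) → Simple p → len p < n
  Simple⇒len<n p simp = injective⇒≤ (nodeAt-injective p simp)

  -- Simple paths have fewer than n steps, so Within n decides reachability.
  Within : ℕ → Fin n → Fin n → Set
  Within zero    a b = a ≡ b
  Within (suc m) a b = a ≡ b ⊎ ∃[ w ] ∃[ e ] (Joins G e a w × Within m w b)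

  anyEdge? : {P : Pred (Edge G) 0ℓ} → Decidable P → Dec (∃ P)
  anyEdge? P? = map′ (λ { (inj₁ (i , Pi)) → inj₁ i , Pi ; (inj₂ (j , Pj)) → inj₂ j , Pj })
                     (λ { (inj₁ i , Pi) → inj₁ (i , Pi) ; (inj₂ j , Pj) → inj₂ (j , Pj) })
                     (any? (P? ∘ inj₁) ⊎-dec any? (P? ∘ inj₂))

  Within? : ∀ m a b → Dec (Within m a b)
  Within? zero    a b = a ≟ b
  Within? (suc m) a b = (a ≟ b) ⊎-dec any? λ w → anyEdge? λ e → Joins? e a w ×-dec Within? m w b

  Within⇒path : ∀ m {a b} → Within m a b → SDPath G a b
  Within⇒path zero    refl                   = here
  Within⇒path (suc m) (inj₁ refl)            = here
  Within⇒path (suc m) (inj₂ (w , e , J , W)) = step e J (Within⇒path m W)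

  path⇒Within : ∀ {m a b} (p : SDPath G a b) → len p ≤ m → Within m a b
  path⇒Within {zero}  here         _         = refl
  path⇒Within {suc m} here         _         = inj₁ refl
  path⇒Within {suc m} (step e J p) (s≤s len≤) = inj₂ (_ , e , J , path⇒Within p len≤)

  SDPath? : ∀ a b → Dec (SDPath G a b)
  SDPath? a b = map′ (Within⇒path n) within (Within? n a b)
    where
    within : SDPath G a b → Within n a b
    within p = let q , simp = simplify p in path⇒Within q (<⇒≤ (Simple⇒len<n q simp))

  closeCycle : ∀ {y z} (p : SDPath G y z) → Simple p → ∀ j → D G j ≡ (z , y) → SDCycle G
  closeCycle {y} {z} p simp j z→y = record
    { k = len p ; node = nodeAt p ; edge = cycleEdge
    ; node-inj = nodeAt-injective p simp ; edge-inj = cycleEdge-injective ; step = cycleStep }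
    where
    cycleEdge : Fin (suc (len p)) → Edge G
    cycleEdge t with lastView t
    ... | inner s = edgeAt p s
    ... | last    = inj₂ j

    cycleStep : ∀ t → Joins G (cycleEdge t) (nodeAt p t) (nodeAt p (cnext t))
    cycleStep t with lastView t
    ... | inner s rewrite cnext-inject₁ s = nodeAt-step p s
    ... | last    rewrite cnext-fromℕ (len p) | nodeAt-last p = z→y

    closing-edge-unrepeated : ∀ s → edgeAt p s ≢ inj₂ j
    closing-edge-unrepeated s eq = fromℕ≢inject₁ {i = s} (nodeAt-injective p simp (begin
      nodeAt p (fromℕ (len p)) ≡⟨ nodeAt-last p ⟩
      z                        ≡⟨ cong proj₁ z→y ⟨
      proj₁ (D G j)            ≡⟨ cong proj₁ closing-step ⟩
      nodeAt p (inject₁ s)     ∎))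
      where
      open ≡-Reasoning
      closing-step : Joins G (inj₂ j) (nodeAt p (inject₁ s)) (nodeAt p (suc s))
      closing-step = subst (λ e → Joins G e (nodeAt p (inject₁ s)) (nodeAt p (suc s))) eq (nodeAt-step p s)

    cycleEdge-injective : ∀ {t₁ t₂} → cycleEdge t₁ ≡ cycleEdge t₂ → t₁ ≡ t₂
    cycleEdge-injective {t₁} {t₂} eq with lastView t₁ | lastView t₂
    ... | inner s₁ | inner s₂ = cong inject₁ (edgeAt-injective p simp eq)
    ... | inner s  | last     = ⊥-elim (closing-edge-unrepeated s eq)
    ... | last     | inner s  = ⊥-elim (closing-edge-unrepeated s (sym eq))
    ... | last     | last     = refl

  no-return-path : Acyclic G → ∀ {j y z} → D G j ≡ (z , y) → ¬ SDPath G y z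
  no-return-path acyclic z→y p = let q , simp = simplify p in acyclic (closeCycle q simp _ z→y)

orientPair-Joins : ∀ {n} d {p : Fin n × Fin n} {a b} → orientPair d p ≡ (a , b) → p ≡ (a , b) ⊎ p ≡ (b , a)
orientPair-Joins fwd eq = inj₁ eq
orientPair-Joins bwd eq = inj₂ (cong Product.swap eq)

orientPair-Joins⁻ : ∀ {n} d {p : Fin n × Fin n} {a b} → p ≡ (a , b) ⊎ p ≡ (b , a) →
                    orientPair d p ≡ (a , b) ⊎ orientPair d p ≡ (b , a)
orientPair-Joins⁻ fwd a-b         = a-b
orientPair-Joins⁻ bwd (inj₁ refl) = inj₂ refl
orientPair-Joins⁻ bwd (inj₂ refl) = inj₁ refl

flipDir : Dir → Dir
flipDir fwd = bwd
flipDir bwd = fwd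

orientPair-flipDir : ∀ {n} d (p : Fin n × Fin n) → orientPair (flipDir d) p ≡ Product.swap (orientPair d p)
orientPair-flipDir fwd _ = refl
orientPair-flipDir bwd _ = refl

Incident : ∀ {n} → Fin n → Fin n × Fin n → Set
Incident v (a , b) = a ≡ v ⊎ b ≡ v

orientPair-Incident⁺ : ∀ {n} d {p : Fin n × Fin n} {v} → Incident v p → Incident v (orientPair d p)
orientPair-Incident⁺ fwd         v∈p        = v∈p
orientPair-Incident⁺ bwd {a , b} (inj₁ a≡v) = inj₂ a≡v
orientPair-Incident⁺ bwd {a , b} (inj₂ b≡v) = inj₁ b≡v

orientPair-Incident⁻ : ∀ {n} d {p : Fin n × Fin n} {v} → Incident v (orientPair d p) → Incident v p
orientPair-Incident⁻ fwd         v∈p        = v∈p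
orientPair-Incident⁻ bwd {a , b} (inj₁ b≡v) = inj₂ b≡v
orientPair-Incident⁻ bwd {a , b} (inj₂ a≡v) = inj₁ a≡v

module _ {n : ℕ} (N : SDGraph n) where

  origin : Fin (mD N + mU N) → Edge N
  origin k = swap (splitAt (mD N) k)

  origin-injective : Injective _≡_ _≡_ origin
  origin-injective {k₁} {k₂} eq = begin
    k₁                                     ≡⟨ join-splitAt (mD N) (mU N) k₁ ⟨
    join (mD N) (mU N) (splitAt (mD N) k₁) ≡⟨ cong (join (mD N) (mU N)) splitAt-eq ⟩
    join (mD N) (mU N) (splitAt (mD N) k₂) ≡⟨ join-splitAt (mD N) (mU N) k₂ ⟩
    k₂                                     ∎
    where
    open ≡-Reasoning
    splitAt-eq : splitAt (mD N) k₁ ≡ splitAt (mD N) k₂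
    splitAt-eq = trans (sym (swap-involutive _)) (trans (cong swap eq) (swap-involutive _))

  data EdgeView : Fin (mD N + mU N) → Set where
    directed   : ∀ j → EdgeView (j ↑ˡ mU N)
    undirected : ∀ i → EdgeView (mD N ↑ʳ i)

  edgeView : ∀ k → EdgeView k
  edgeView k with splitAt (mD N) k in eq
  ... | inj₁ j = subst EdgeView (splitAt⁻¹-↑ˡ eq) (directed j)
  ... | inj₂ i = subst EdgeView (splitAt⁻¹-↑ʳ eq) (undirected i)

  ↑ˡ≢↑ʳ : ∀ {j i} → j ↑ˡ mU N ≢ mD N ↑ʳ i
  ↑ˡ≢↑ʳ {j} {i} eq with trans (sym (splitAt-↑ˡ (mD N) j (mU N))) (trans (cong (splitAt (mD N)) eq) (splitAt-↑ʳ (mD N) (mU N) i))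
  ... | ()

  module _ (σ : Fin (mU N) → Dir) where

    orient-↑ˡ : ∀ j → D (orient N σ) (j ↑ˡ mU N) ≡ D N j
    orient-↑ˡ j rewrite splitAt-↑ˡ (mD N) j (mU N) = refl

    orient-↑ʳ : ∀ i → D (orient N σ) (mD N ↑ʳ i) ≡ orientPair (σ i) (U N i)
    orient-↑ʳ i rewrite splitAt-↑ʳ (mD N) (mU N) i = refl

    orient-Joins : ∀ k {a b} → D (orient N σ) k ≡ (a , b) → Joins N (origin k) a b
    orient-Joins k eq with edgeView k
    ... | directed j   rewrite splitAt-↑ˡ (mD N) j (mU N) = eq
    ... | undirected i rewrite splitAt-↑ʳ (mD N) (mU N) i = orientPair-Joins (σ i) eq

    liftEdge : Edge (orient N σ) → Edge N
    liftEdge (inj₂ k) = origin k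

    liftEdge-injective : Injective _≡_ _≡_ liftEdge
    liftEdge-injective {inj₂ k₁} {inj₂ k₂} eq = cong inj₂ (origin-injective eq)

    lift-Joins : ∀ e {a b} → Joins (orient N σ) e a b → Joins N (liftEdge e) a b
    lift-Joins (inj₂ k) = orient-Joins k

    orient-path : ∀ {a b} → SDPath (orient N σ) a b → SDPath N a b
    orient-path here         = here
    orient-path (step e J p) = step (liftEdge e) (lift-Joins e J) (orient-path p)

    orient-acyclic : Acyclic N → Acyclic (orient N σ)
    orient-acyclic acyclic C = acyclic record
      { k = k ; node = node ; edge = liftEdge ∘ edge ; node-inj = node-inj
      ; edge-inj = edge-inj ∘ liftEdge-injective ; step = λ t → lift-Joins (edge t) (cycle-step t) }
      where open SDCycle C renaming (step to cycle-step)

    orient-avoids : (π : Fin n × Fin n → Fin n) {v : Fin n} →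
                    (∀ k → π (D (orient N σ) k) ≢ v) ⇔ ((∀ j → π (D N j) ≢ v) × (∀ i → π (orientPair (σ i) (U N i)) ≢ v))
    orient-avoids π = mk⇔
      (λ avoid → (λ j → avoid (j ↑ˡ mU N) ∘ trans (cong π (orient-↑ˡ j)))
               , (λ i → avoid (mD N ↑ʳ i) ∘ trans (cong π (orient-↑ʳ i))))
      (λ (avoidD , avoidU) k → avoids avoidD avoidU k (edgeView k))
      where
      avoids : ∀ {v} → (∀ j → π (D N j) ≢ v) → (∀ i → π (orientPair (σ i) (U N i)) ≢ v) →
               ∀ k → EdgeView k → π (D (orient N σ) k) ≢ v
      avoids avoidD avoidU _ (directed j)   = avoidD j ∘ trans (cong π (sym (orient-↑ˡ j)))
      avoids avoidD avoidU _ (undirected i) = avoidU i ∘ trans (cong π (sym (orient-↑ʳ i)))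

module _ {n : ℕ} (N : SDGraph n) where

  parent child : (Fin (mU N) → Dir) → Fin (mD N + mU N) → Fin n
  parent σ k = proj₁ (D (orient N σ) k)
  child  σ k = proj₂ (D (orient N σ) k)

  undirected-sole-in-edge : ∀ {σ} → IsRootedPartner N σ → ∀ i k → child σ k ≡ child σ (mD N ↑ʳ i) → k ≡ mD N ↑ʳ i
  undirected-sole-in-edge {σ} (_ , _ , nonhybrid) i k same-child with k ≟ mD N ↑ʳ i
  ... | yes eq  = eq
  ... | no  k≢i = ⊥-elim (nonhybrid i (count≥2 (λ k → child σ k ≟ child σ (mD N ↑ʳ i)) k≢i same-child refl))

  reverse : (Fin (mU N) → Dir) → Fin (mU N) → Fin (mU N) → Dir
  reverse σ i i′ with i′ ≟ i
  ... | yes _ = flipDir (σ i′)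
  ... | no  _ = σ i′

  reverse-at : ∀ σ i → reverse σ i i ≡ flipDir (σ i)
  reverse-at σ i with i ≟ i
  ... | yes _   = refl
  ... | no  i≢i = ⊥-elim (i≢i refl)

  reverse-elsewhere : ∀ σ {i i′} → i′ ≢ i → reverse σ i i′ ≡ σ i′
  reverse-elsewhere σ {i} {i′} i′≢i with i′ ≟ i
  ... | yes i′≡i = ⊥-elim (i′≢i i′≡i)
  ... | no  _    = refl

  reverse-reversed : ∀ σ i → D (orient N (reverse σ i)) (mD N ↑ʳ i) ≡ Product.swap (D (orient N σ) (mD N ↑ʳ i))
  reverse-reversed σ i = begin
    D (orient N (reverse σ i)) (mD N ↑ʳ i)    ≡⟨ orient-↑ʳ N (reverse σ i) i ⟩
    orientPair (reverse σ i i) (U N i)        ≡⟨ cong (λ d → orientPair d (U N i)) (reverse-at σ i) ⟩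
    orientPair (flipDir (σ i)) (U N i)        ≡⟨ orientPair-flipDir (σ i) (U N i) ⟩
    Product.swap (orientPair (σ i) (U N i))   ≡⟨ cong Product.swap (orient-↑ʳ N σ i) ⟨
    Product.swap (D (orient N σ) (mD N ↑ʳ i)) ∎
    where open ≡-Reasoning

  reverse-unchanged : ∀ σ i {k} → k ≢ mD N ↑ʳ i → D (orient N (reverse σ i)) k ≡ D (orient N σ) k
  reverse-unchanged σ i {k} k≢i with edgeView N k
  ... | directed j    = trans (orient-↑ˡ N (reverse σ i) j) (sym (orient-↑ˡ N σ j))
  ... | undirected i′ = begin
    D (orient N (reverse σ i)) (mD N ↑ʳ i′) ≡⟨ orient-↑ʳ N (reverse σ i) i′ ⟩
    orientPair (reverse σ i i′) (U N i′)    ≡⟨ cong (λ d → orientPair d (U N i′)) (reverse-elsewhere σ (k≢i ∘ cong (mD N ↑ʳ_))) ⟩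
    orientPair (σ i′) (U N i′)              ≡⟨ orient-↑ʳ N σ i′ ⟨
    D (orient N σ) (mD N ↑ʳ i′)             ∎
    where open ≡-Reasoning

  -- Reversing the out-edge r → x of a source r moves the in-degree 1 of x to r and changes no
  -- other in-degree, so hybrid edges are preserved.
  module Reversal (acyclic : Acyclic N) {σ} (partner : IsRootedPartner N σ)
                  {i r x} (r→x : D (orient N σ) (mD N ↑ʳ i) ≡ (r , x)) (r-source : deg-i (orient N σ) r ≡ 0) where

    σ′ : Fin (mU N) → Dir
    σ′ = reverse σ i

    k* : Fin (mD N + mU N)
    k* = mD N ↑ʳ i

    no-edge-into-r : ∀ k → child σ k ≢ r
    no-edge-into-r = count≡0⇒∁ (λ k → child σ k ≟ r) r-source

    sole-edge-into-x : ∀ k → child σ k ≡ x → k ≡ k*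
    sole-edge-into-x k into-x = undirected-sole-in-edge partner i k (trans into-x (sym (cong proj₂ r→x)))

    x→r : D (orient N σ′) k* ≡ (x , r)
    x→r = trans (reverse-reversed σ i) (cong Product.swap r→x)

    r≢x : r ≢ x
    r≢x r≡x = no-edge-into-r k* (trans (cong proj₂ r→x) (sym r≡x))

    child-unchanged : ∀ {k} → k ≢ k* → child σ′ k ≡ child σ k
    child-unchanged k≢k* = cong proj₂ (reverse-unchanged σ i k≢k*)

    in-degree-unchanged : ∀ {w} → w ≢ r → w ≢ x → deg-i (orient N σ′) w ≡ deg-i (orient N σ) w
    in-degree-unchanged {w} w≢r w≢x = count-cong (λ k → child σ′ k ≟ w) (λ k → child σ k ≟ w)
      ((λ {k} → to k) , (λ {k} → from k))
      where
      to : ∀ k → child σ′ k ≡ w → child σ k ≡ w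
      to k into-w with k ≟ k*
      ... | yes refl  = ⊥-elim (w≢r (trans (sym into-w) (cong proj₂ x→r)))
      ... | no  k≢k* = trans (sym (child-unchanged k≢k*)) into-w
      from : ∀ k → child σ k ≡ w → child σ′ k ≡ w
      from k into-w with k ≟ k*
      ... | yes refl  = ⊥-elim (w≢x (trans (sym into-w) (cong proj₂ r→x)))
      ... | no  k≢k* = trans (child-unchanged k≢k*) into-w

    hybrid-unchanged : ∀ {k} → k ≢ k* → IsHybridEdge (orient N σ′) k ⇔ IsHybridEdge (orient N σ) k
    hybrid-unchanged {k} k≢k* = subst (λ w → 2 ≤ deg-i (orient N σ′) w ⇔ 2 ≤ deg-i (orient N σ) (child σ k))
                                      (sym (child-unchanged k≢k*))
                                      (mk⇔ (subst (2 ≤_) deg≡) (subst (2 ≤_) (sym deg≡)))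
      where
      deg≡ : deg-i (orient N σ′) (child σ k) ≡ deg-i (orient N σ) (child σ k)
      deg≡ = in-degree-unchanged (no-edge-into-r k) (k≢k* ∘ sole-edge-into-x k)

    r-in-degree≤1 : deg-i (orient N σ′) r ≤ 1
    r-in-degree≤1 = count≤1 (λ k → child σ′ k ≟ r) λ {k₁} {k₂} into₁ into₂ → trans (only k₁ into₁) (sym (only k₂ into₂))
      where
      only : ∀ k → child σ′ k ≡ r → k ≡ k*
      only k into-r with k ≟ k*
      ... | yes k≡k* = k≡k*
      ... | no  k≢k* = ⊥-elim (no-edge-into-r k (trans (sym (child-unchanged k≢k*)) into-r))

    x-source : deg-i (orient N σ′) x ≡ 0
    x-source = ∁⇒count≡0 (λ k → child σ′ k ≟ x) not-into-x
      where
      not-into-x : ∀ k → child σ′ k ≢ x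
      not-into-x k into-x with k ≟ k*
      ... | yes refl  = r≢x (trans (sym (cong proj₂ x→r)) into-x)
      ... | no  k≢k* = k≢k* (sole-edge-into-x k (trans (sym (child-unchanged k≢k*)) into-x))

    partner′ : IsRootedPartner N σ′
    partner′ = orient-acyclic N σ′ acyclic
             , (λ j → ⇔-sym (hybrid-unchanged (↑ˡ≢↑ʳ N)) ⇔-∘ proj₁ (proj₂ partner) j)
             , nonhybrid
      where
      nonhybrid : ∀ i′ → ¬ IsHybridEdge (orient N σ′) (mD N ↑ʳ i′)
      nonhybrid i′ hybrid with i′ ≟ i
      ... | yes refl = <-irrefl refl (≤-trans (subst (λ w → 2 ≤ deg-i (orient N σ′) w) (cong proj₂ x→r) hybrid) r-in-degree≤1)
      ... | no  i′≢i = proj₂ (proj₂ partner) i′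
                         (Equivalence.to (hybrid-unchanged (i′≢i ∘ ↑ʳ-injective (mD N) i′ i)) hybrid)

    path-transport : ∀ {a b} → a ≢ r → (p : SDPath (orient N σ) a b) →
                     Σ (SDPath (orient N σ′) a b) λ q → len _ q ≡ len _ p
    path-transport a≢r here = here , refl
    path-transport a≢r (step {w = c} (inj₂ k) a→c p) with k ≟ k*
    ... | yes refl  = ⊥-elim (a≢r (trans (sym (cong proj₁ a→c)) (cong proj₁ r→x)))
    ... | no  k≢k* with path-transport (no-edge-into-r k ∘ trans (cong proj₂ a→c)) p
    ...   | q , len≡ = step (inj₂ k) (trans (reverse-unchanged σ i k≢k*) a→c) q , cong suc len≡

module _ {n : ℕ} (G : SDGraph n) (acyclic : Acyclic G) where

  -- The ancestor count drops strictly from a node to its parent, so searching backwards for a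
  -- source terminates.
  ancestors : Fin n → ℕ
  ancestors w = count (λ u → SDPath? G u w)

  parent-has-fewer-ancestors : ∀ {k u w} → D G k ≡ (u , w) → ancestors u < ancestors w
  parent-has-fewer-ancestors {k} {u} {w} u→w =
    count-< (λ a → SDPath? G a u) (λ a → SDPath? G a w)
            (λ a⇝u → _++ₚ_ G a⇝u (step (inj₂ k) u→w here)) here (no-return-path G acyclic u→w)

  source-above : ∀ w → ∃[ r ] deg-i G r ≡ 0 × SDPath G r w
  source-above w = go w (On.wellFounded ancestors <-wellFounded w)
    where
    go : ∀ w → Acc (_<_ on ancestors) w → ∃[ r ] deg-i G r ≡ 0 × SDPath G r w
    go w (acc smaller) with any? (λ k → proj₂ (D G k) ≟ w)
    ... | no  no-in-edge  = w , ∁⇒count≡0 (λ k → proj₂ (D G k) ≟ w) (λ k into-w → no-in-edge (k , into-w)) , here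
    ... | yes (k , refl) with go (proj₁ (D G k)) (smaller (parent-has-fewer-ancestors refl))
    ...   | r , r-source , r⇝u = r , r-source , _++ₚ_ G r⇝u (step (inj₂ k) refl here)

module _ {n : ℕ} (N : SDGraph n) (acyclic : Acyclic N) {v : Fin n} (v-root : InVR N v) where

  no-directed-edge-above : ∀ {j a b} → D N j ≡ (a , b) → ¬ SDPath N b v
  no-directed-edge-above {j} a→b b⇝v =
    no-return-path N acyclic a→b (_++ₚ_ N b⇝v (v-root _ (step (inj₂ j) a→b b⇝v)))

  reroot : ∀ m {σ r} → IsRootedPartner N σ → deg-i (orient N σ) r ≡ 0 →
           (p : SDPath (orient N σ) r v) → len _ p ≡ m →
           ∃[ τ ] IsRootedPartner N τ × deg-i (orient N τ) v ≡ 0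
  reroot _ {σ} partner r-source here _ = σ , partner , r-source
  reroot (suc m) {σ} partner r-source (step (inj₂ k) r→x x⇝v) len≡ with edgeView N k
  ... | directed j    = ⊥-elim (no-directed-edge-above (trans (sym (orient-↑ˡ N σ j)) r→x) (orient-path N σ x⇝v))
  ... | undirected i  =
    let open Reversal N acyclic partner r→x r-source
        q , len-q = path-transport (r≢x ∘ sym) x⇝v
    in  reroot m partner′ x-source q (trans len-q (suc-injective len≡))

InVR⇒source-of-partner : ∀ {n} (N : SDGraph n) → IsNetwork N → ∀ {v} → InVR N v →
                         ∃[ τ ] IsRootedPartner N τ × deg-i (orient N τ) v ≡ 0
InVR⇒source-of-partner N (acyclic , σ , partner) {v} v-root =
  let r , r-source , r⇝v = source-above (orient N σ) (proj₁ partner) v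
  in  reroot N acyclic v-root _ partner r-source r⇝v refl

module _ {n : ℕ} (N : SDGraph n) {τ} (partner : IsRootedPartner N τ) {v : Fin n} (v-source : deg-i (orient N τ) v ≡ 0) where

  -- Every downstream node other than v has its undirected in-edge as its only in-edge, which
  -- makes the downstream set closed under predecessors in N.
  data Downstream : Fin n → Set where
    start : Downstream v
    down  : ∀ i {a b} → D (orient N τ) (mD N ↑ʳ i) ≡ (a , b) → Downstream a → Downstream b

  Downstream⇒path : ∀ {w} → Downstream w → SDPath N v w
  Downstream⇒path start = here
  Downstream⇒path (down i a→b below) =
    _++ₚ_ N (Downstream⇒path below) (step (inj₁ i) (orientPair-Joins (τ i) (trans (sym (orient-↑ʳ N τ i)) a→b)) here)

  no-edge-into-v : ∀ k → child N τ k ≢ v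
  no-edge-into-v = count≡0⇒∁ (λ k → child N τ k ≟ v) v-source

  Downstream-sole-in-edge : ∀ {k a b} → D (orient N τ) k ≡ (a , b) → Downstream b →
                            ∃[ i ] k ≡ mD N ↑ʳ i × Downstream a
  Downstream-sole-in-edge {k} a→v start = ⊥-elim (no-edge-into-v k (cong proj₂ a→v))
  Downstream-sole-in-edge {k} a→b (down i a′→b below)
    with undirected-sole-in-edge N partner i k (trans (cong proj₂ a→b) (sym (cong proj₂ a′→b)))
  ... | refl = i , refl , subst Downstream (cong proj₁ (trans (sym a′→b) a→b)) below

  Downstream-upward-closed : ∀ e {a b} → Joins N e a b → Downstream b → Downstream a
  Downstream-upward-closed (inj₂ j) a→b below with Downstream-sole-in-edge (trans (orient-↑ˡ N τ j) a→b) below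
  ... | i , eq , _ = ⊥-elim (↑ˡ≢↑ʳ N eq)
  Downstream-upward-closed (inj₁ i) a-b below with orientPair-Joins⁻ (τ i) a-b
  ... | inj₁ a→b = proj₂ (proj₂ (Downstream-sole-in-edge (trans (orient-↑ʳ N τ i) a→b) below))
  ... | inj₂ b→a = down i (trans (orient-↑ʳ N τ i) b→a) below

  source-of-partner⇒InVR : InVR N v
  source-of-partner⇒InVR u u⇝v = Downstream⇒path (upward u⇝v)
    where
    upward : ∀ {u} → SDPath N u v → Downstream u
    upward here         = start
    upward (step e J p) = Downstream-upward-closed e J (upward p)

module _ {n : ℕ} (N : SDGraph n) where

  Touches : Fin n → Fin (mU N) → Set
  Touches v i = Incident v (U N i)

  touches? : ∀ v i → Dec (Touches v i)
  touches? v i = (proj₁ (U N i) ≟ v) ⊎-dec (proj₂ (U N i) ≟ v)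

  deg-u≡count : ∀ v → deg-u N v ≡ count (touches? v)
  deg-u≡count v = count-∪ (λ i → proj₁ (U N i) ≟ v) (λ i → proj₂ (U N i) ≟ v)
                          (λ {i} a≡v b≡v → U-noloop N i (trans a≡v (sym b≡v)))

  module _ {v : Fin n} where

    deg-u≡1⇒touched : deg-u N v ≡ 1 → ∃ (Touches v)
    deg-u≡1⇒touched deg≡1 with any? (touches? v)
    ... | yes touched   = touched
    ... | no  untouched = ⊥-elim (0≢1+n (trans (sym (∁⇒count≡0 (touches? v) (λ i t → untouched (i , t))))
                                                (trans (sym (deg-u≡count v)) deg≡1)))

    deg-u≡1⇒touched-once : deg-u N v ≡ 1 → ∀ {i i′} → Touches v i → Touches v i′ → i ≡ i′
    deg-u≡1⇒touched-once deg≡1 {i} {i′} t t′ with i ≟ i′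
    ... | yes i≡i′ = i≡i′
    ... | no  i≢i′ = ⊥-elim (<-irrefl refl (subst (2 ≤_) (trans (sym (deg-u≡count v)) deg≡1)
                                                   (count≥2 (touches? v) i≢i′ t t′)))

    touched-once⇒deg-u≡1 : ∀ {i} → Touches v i → (∀ {i′} → Touches v i′ → i′ ≡ i) → deg-u N v ≡ 1
    touched-once⇒deg-u≡1 t once = trans (deg-u≡count v)
      (≤-antisym (count≤1 (touches? v) (λ t₁ t₂ → trans (once t₁) (sym (once t₂)))) (count-pos (touches? v) t))

  module _ (τ : Fin (mU N) → Dir) {v : Fin n} where

    private
      oriented : Fin (mU N) → Fin n × Fin n
      oriented i = orientPair (τ i) (U N i)

      oriented-noloop : ∀ i → proj₁ (oriented i) ≢ proj₂ (oriented i)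
      oriented-noloop i = orientPair-noloop (τ i) (U N i) (U-noloop N i)

    orient-leaf⇔ : IsLeafIn N (orient N τ) v ⇔ (deg-o N v ≡ 0 × ∀ i → Touches v i → proj₂ (oriented i) ≡ v)
    orient-leaf⇔ = mk⇔ to from
      where
      to : IsLeafIn N (orient N τ) v → deg-o N v ≡ 0 × ∀ i → Touches v i → proj₂ (oriented i) ≡ v
      to leaf with Equivalence.to (orient-avoids N τ proj₁) (count≡0⇒∁ (λ k → parent N τ k ≟ v) leaf)
      ... | no-directed , no-undirected = ∁⇒count≡0 (λ j → proj₁ (D N j) ≟ v) no-directed , into
        where
        into : ∀ i → Touches v i → proj₂ (oriented i) ≡ v
        into i t with orientPair-Incident⁺ (τ i) t
        ... | inj₁ tail≡v = ⊥-elim (no-undirected i tail≡v)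
        ... | inj₂ head≡v = head≡v
      from : deg-o N v ≡ 0 × (∀ i → Touches v i → proj₂ (oriented i) ≡ v) → IsLeafIn N (orient N τ) v
      from (deg-o≡0 , into) = ∁⇒count≡0 (λ k → parent N τ k ≟ v)
        (Equivalence.from (orient-avoids N τ proj₁) (count≡0⇒∁ (λ j → proj₁ (D N j) ≟ v) deg-o≡0 , not-out))
        where
        not-out : ∀ i → proj₁ (oriented i) ≢ v
        not-out i tail≡v = oriented-noloop i (trans tail≡v (sym (into i (orientPair-Incident⁻ (τ i) (inj₁ tail≡v)))))

    orient-source⇐ : deg-i N v ≡ 0 → (∀ i → Touches v i → proj₁ (oriented i) ≡ v) → deg-i (orient N τ) v ≡ 0
    orient-source⇐ deg-i≡0 out = ∁⇒count≡0 (λ k → child N τ k ≟ v)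
      (Equivalence.from (orient-avoids N τ proj₂) (count≡0⇒∁ (λ j → proj₂ (D N j) ≟ v) deg-i≡0 , not-in))
      where
      not-in : ∀ i → proj₂ (oriented i) ≢ v
      not-in i head≡v = oriented-noloop i (trans (out i (orientPair-Incident⁻ (τ i) (inj₂ head≡v))) (sym head≡v))

  module Pendant {v : Fin n} (deg-u≡1 : deg-u N v ≡ 1) (deg-o≡0 : deg-o N v ≡ 0) (deg-i≡0 : deg-i N v ≡ 0) where

    i* : Fin (mU N)
    i* = proj₁ (deg-u≡1⇒touched deg-u≡1)

    k* : Fin (mD N + mU N)
    k* = mD N ↑ʳ i*

    touched-only-by-i* : ∀ {i} → Touches v i → i ≡ i*
    touched-only-by-i* t = deg-u≡1⇒touched-once deg-u≡1 t (proj₂ (deg-u≡1⇒touched deg-u≡1))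

    k*-incident : ∀ τ → Incident v (D (orient N τ) k*)
    k*-incident τ = subst (Incident v) (sym (orient-↑ʳ N τ i*))
                          (orientPair-Incident⁺ (τ i*) (proj₂ (deg-u≡1⇒touched deg-u≡1)))

    only-k* : ∀ τ {i} → Touches v i → D (orient N τ) k* ≡ orientPair (τ i) (U N i)
    only-k* τ t rewrite touched-only-by-i* t = orient-↑ʳ N τ i*

    leaf-if-into : ∀ τ → child N τ k* ≡ v → IsLeafIn N (orient N τ) v
    leaf-if-into τ into = Equivalence.from (orient-leaf⇔ τ) (deg-o≡0 , λ i t → trans (cong proj₂ (sym (only-k* τ t))) into)

    source-if-out : ∀ τ → parent N τ k* ≡ v → deg-i (orient N τ) v ≡ 0
    source-if-out τ out = orient-source⇐ τ deg-i≡0 (λ i t → trans (cong proj₁ (sym (only-k* τ t))) out)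

RootPendant : ∀ {n} → SDGraph n → Fin n → Set
RootPendant N v = InVR N v × deg-u N v ≡ 1 × deg-o N v ≡ 0 × deg-i N v ≡ 0

module _ {n : ℕ} (N : SDGraph n) {v : Fin n} where

  ambiguous-leaf⇒root-pendant : AmbiguousLeaf N v → RootPendant N v
  ambiguous-leaf⇒root-pendant ((σ , partner , leaf) , not-rooted) = v-root , deg-u≡1 , deg-o≡0 , deg-i≡0
    where
    deg-o≡0 : deg-o N v ≡ 0
    deg-o≡0 = proj₁ (Equivalence.to (orient-leaf⇔ N σ) leaf)

    into-v : ∀ i → Touches N v i → child N σ (mD N ↑ʳ i) ≡ v
    into-v i t = trans (cong proj₂ (orient-↑ʳ N σ i)) (proj₂ (Equivalence.to (orient-leaf⇔ N σ) leaf) i t)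

    touched : ∃ (Touches N v)
    touched with any? (touches? N v)
    ... | yes t         = t
    ... | no  untouched = ⊥-elim (not-rooted λ τ _ →
                            Equivalence.from (orient-leaf⇔ N τ) (deg-o≡0 , λ i t → ⊥-elim (untouched (i , t))))

    i₀ : Fin (mU N)
    i₀ = proj₁ touched

    sole-in-edge : ∀ k → child N σ k ≡ v → k ≡ mD N ↑ʳ i₀
    sole-in-edge k into = undirected-sole-in-edge N partner i₀ k (trans into (sym (into-v i₀ (proj₂ touched))))

    deg-u≡1 : deg-u N v ≡ 1
    deg-u≡1 = touched-once⇒deg-u≡1 N (proj₂ touched)
      λ {i} t → ↑ʳ-injective (mD N) i i₀ (sole-in-edge (mD N ↑ʳ i) (into-v i t))

    deg-i≡0 : deg-i N v ≡ 0
    deg-i≡0 = ∁⇒count≡0 (λ j → proj₂ (D N j) ≟ v)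
      λ j into → ↑ˡ≢↑ʳ N (sole-in-edge (j ↑ˡ mU N) (trans (cong proj₂ (orient-↑ˡ N σ j)) into))

    open Pendant N deg-u≡1 deg-o≡0 deg-i≡0

    -- Constructively, v ⇝ u is obtained by deciding it: if it failed, v would be a leaf of
    -- every partner.
    v-root : InVR N v
    v-root u u⇝v with SDPath? N v u
    ... | yes v⇝u = v⇝u
    ... | no  v⇝̸u = ⊥-elim (not-rooted leaf-in)
      where
      leaf-in : RootedLeaf N v
      leaf-in τ τ-partner with k*-incident τ
      ... | inj₂ into = leaf-if-into τ into
      ... | inj₁ out  = ⊥-elim (v⇝̸u (source-of-partner⇒InVR N τ-partner (source-if-out τ out) u u⇝v))

  root-pendant⇒ambiguous-leaf : IsNetwork N → RootPendant N v → AmbiguousLeaf N v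
  root-pendant⇒ambiguous-leaf network@(acyclic , σ , partner) (v-root , deg-u≡1 , deg-o≡0 , deg-i≡0) =
    unrooted , not-rooted
    where
    open Pendant N deg-u≡1 deg-o≡0 deg-i≡0

    unrooted : UnrootedLeaf N v
    unrooted with k*-incident σ
    ... | inj₂ into = σ , partner , leaf-if-into σ into
    ... | inj₁ out  = reverse N σ i* , partner′ , leaf-if-into (reverse N σ i*) (cong proj₂ x→r)
      where open Reversal N acyclic partner (cong (_, child N σ k*) out) (source-if-out σ out)

    not-rooted : ¬ RootedLeaf N v
    not-rooted rooted with InVR⇒source-of-partner N network v-root
    ... | τ , τ-partner , source with k*-incident τ
    ...   | inj₁ out  = count≡0⇒∁ (λ k → parent N τ k ≟ v) (rooted τ τ-partner) k* out
    ...   | inj₂ into = count≡0⇒∁ (λ k → child N τ k ≟ v) source k* into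

lemma3 : ∀ {n : ℕ} (N : SDGraph n) → IsNetwork N → (v : Fin n) →
         AmbiguousLeaf N v ⇔ (InVR N v × deg-u N v ≡ 1 × deg-o N v ≡ 0 × deg-i N v ≡ 0)
lemma3 N network v = mk⇔ (ambiguous-leaf⇒root-pendant N) (root-pendant⇒ambiguous-leaf N network)
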